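{- Let $\sigma$ be a signature and $k$ a natural number. (i) For any generalized causal team $T$ over $\sigma$, $T\models^g\chi_k$ iff $|T/_{\approx}|\leq k$. (ii) For any causal team $T=(T^-,\mathcal F)$ over $\sigma$, $T\models^c\chi_k$ iff $|T^-|\leq k$.
   Context: Signature $\sigma=(\mathrm{Dom},\mathrm{Ran})$, $\mathrm{Dom}$ nonempty finite, $\mathrm{Ran}(X)$ nonempty finite. $\mathbf X=\mathbf x$ abbreviates $X_1=x_1\wedge\dots\wedge X_n=x_n$, inconsistent if two conjuncts give one variable distinct values. Systems of functions $\mathcal F$: for $V\in\mathrm{En}(\mathcal F)\subseteq\mathrm{Dom}$, parents $PA^{\mathcal F}_V\subseteq\mathrm{Dom}\setminus\{V\}$ and $\mathcal F_V:\mathrm{Ran}(PA^{\mathcal F}_V)\to\mathrm{Ran}(V)$; recursive if the parent graph is acyclic; $s$ compatible if $s(V)=\mathcal F_V(s(PA^{\mathcal F}_V))$ for endogenous $V$. Causal team: $(T^-,\mathcal F)$, $\mathcal F$ recursive, $T^-$ a set of compatible assignments (empty ones identified); subteams $(S^-,\mathcal F)$, $S^-\subseteq T^-$. Generalized causal team: set of pairs $(s,\mathcal F)$, $\mathcal F$ recursive, $s$ compatible. Intervention (consistent $\mathbf X=\mathbf x$): $\mathcal F_{\mathbf X=\mathbf x}$ restricts $\mathcal F$ to $\mathrm{En}(\mathcal F)\setminus\mathbf X$; $s^{\mathcal F}_{\mathbf X=\mathbf x}$ is $x_i$ on $X_i$, $s(V)$ on non-intervened exogenous $V$, recursively $\mathcal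 F_V(s^{\mathcal F}_{\mathbf X=\mathbf x}(PA^{\mathcal F}_V))$ otherwise; applied elementwise. Semantics: $T\models X=x$ iff $s(X)=x$ for every assignment $s$ of $T$; $T\models{=}(V)$ (constancy atom) iff all assignments of $T$ agree on $V$; $T\models\neg\alpha$ iff each singleton subteam fails $\alpha$; $\wedge$ usual; $T\models\varphi\vee\psi$ iff $T$ is the union of subteams satisfying $\varphi$, $\psi$ (for causal teams: subteams $(T_1^-,\mathcal F),(T_2^-,\mathcal F)$ with $T_1^-\cup T_2^-=T^-$); $T\models\mathbf X=\mathbf x\;\Box\!\!\rightarrow\varphi$ iff antecedent inconsistent or $T_{\mathbf X=\mathbf x}\models\varphi$. $\bot:=X=x\wedge\neg(X=x)$. Similarity: $\mathcal F_V\sim\mathcal G_V$ iff $\mathcal F_V(\mathbf x\mathbf y)=\mathcal G_V(\mathbf x\mathbf z)$ for all $\mathbf x\in\mathrm{Ran}(PA^{\mathcal F}_V\cap PA^{\mathcal G}_V)$, $\mathbf y\in\mathrm{Ran}(PA^{\mathcal F}_V\setminus PA^{\mathcal G}_V)$, $\mathbf z\in\mathrm{Ran}(PA^{\mathcal G}_V\setminus PA^{\mathcal F}_V)$; $\mathrm{Cn}(\mathcal F)$ = endogenous $V$ with constant $\mathcal F_V$; $\mathcal F\sim\mathcal G$ iff $\mathrm{En}(\mathcal F)\setminus\mathrm{Cn}(\mathcal F)=\mathrm{En}(\mathcal G)\setminus\mathrm{Cn}(\mathcal G)$ and $\mathcal F_V\sim\mathcal G_V$ for these $V$. On pairs, $(s,\mathcal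 F)\approx(t,\mathcal G)$ iff $s=t$ and $\mathcal F\sim\mathcal G$; $T/_{\approx}$ is the set of $\approx$-classes of elements of $T$. Formulas: $\chi:=\bigwedge_{V\in\mathrm{Dom}}\bigwedge_{\mathbf w\in\mathrm{Ran}(\mathbf W_V)}(\mathbf W_V=\mathbf w\;\Box\!\!\rightarrow{=}(V))\wedge\bigwedge_{V\in\mathrm{Dom}}{=}(V)$, where $\mathbf W_V$ lists $\mathrm{Dom}\setminus\{V\}$; $\chi_0:=\bot$ and $\chi_k:=\chi\vee\dots\vee\chi$ ($k$ disjuncts) for $k\geq1$. -}

module Defs where

open import Data.Nat using (ℕ; zero; suc)
open import Data.Fin using (Fin; zero; suc; toℕ; _≟_)
open import Data.Bool using (Bool; true; false; T; not; _∧_)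
open import Data.List using (List; []; _∷_; [_]; map; concatMap; allFin; filter; length)
open import Data.Bool.ListAction using (any)
open import Data.List.Membership.Propositional using (_∈_)
open import Data.List.Relation.Unary.Any using (Any)
open import Data.List.Relation.Unary.AllPairs using (AllPairs)
open import Data.List.Relation.Binary.Pointwise using (Pointwise)
open import Data.Product using (Σ; _×_; _,_; proj₁; proj₂)
open import Data.Sum using (_⊎_)
open import Data.Unit using (⊤)
open import Relation.Nullary using (¬_; ¬?; does)
open import Relation.Binary.PropositionalEquality using (_≡_)

consDep : ∀ {m} {c : Fin (suc m) → ℕ} → Fin (c zero) →
          ((i : Fin m) → Fin (c (suc i))) → (i : Fin (suc m)) → Fin (c i)
consDep x f zero    = x
consDep x f (suc i) = f i

allDep : (m : ℕ) (c : Fin m → ℕ) → List ((i : Fin m) → Fin (c i))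
allDep zero    c = [ (λ ()) ]
allDep (suc m) c =
  concatMap (λ x → map (λ f → consDep {m} {c} x f) (allDep m (λ i → c (suc i))))
            (allFin (c zero))

-- |L / R| = m : there is a list of m pairwise R-inequivalent representatives,
-- all taken from L, such that every element of L is R-related to one of them.
QuotientSize : {A : Set} → (A → A → Set) → List A → ℕ → Set
QuotientSize {A} R L m =
  Σ (List A) λ reps →
    (∀ a → a ∈ reps → a ∈ L) ×
    AllPairs (λ a b → ¬ R a b) reps ×
    (∀ a → a ∈ L → Any (R a) reps) ×
    length reps ≡ m

-- A signature σ = (Dom, Ran): Dom = Fin (suc n) (nonempty, finite),
-- Ran(X) = Fin (suc (r X)) (nonempty, finite).

module Sig (n : ℕ) (r : Fin (suc n) → ℕ) where

  Var : Set
  Var = Fin (suc n)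

  Val : Var → Set
  Val X = Fin (suc (r X))

  Asg : Set
  Asg = (X : Var) → Val X

  _≐_ : Asg → Asg → Set
  s ≐ t = ∀ X → s X ≡ t X

  -- Systems of functions.  en V : V ∈ En(F);  pa V W : W ∈ PA_V.
  -- F_V : Ran(PA_V) → Ran(V) is represented by  fn V : Asg → Val V
  -- that only depends on the values of the parents of V (fn-local).
  -- For exogenous V the fields pa V, fn V are irrelevant.
  record SysFun : Set where
    field
      en        : Var → Bool
      pa        : Var → Var → Bool
      pa-irrefl : ∀ V → pa V V ≡ false
      fn        : (V : Var) → Asg → Val V
      fn-local  : ∀ V (s t : Asg) → (∀ W → T (pa V W) → s W ≡ t W) →
                  fn V s ≡ fn V t
  open SysFun public

  Edge : SysFun → Var → Var → Set
  Edge F W V = T (en F V) × T (pa F V W)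

  data Path (F : SysFun) : Var → Var → Set where
    one  : ∀ {U V} → Edge F U V → Path F U V
    more : ∀ {U W V} → Edge F U W → Path F W V → Path F U V

  Recursive : SysFun → Set
  Recursive F = ∀ V → ¬ Path F V V

  Compatible : SysFun → Asg → Set
  Compatible F s = ∀ V → T (en F V) → s V ≡ fn F V s

  -- antecedents  X₁ = x₁ ∧ … ∧ Xₘ = xₘ
  Ante : Set
  Ante = List (Σ Var Val)

  Inconsistent : Ante → Set
  Inconsistent A =
    Σ (Σ Var Val) λ p → Σ (Σ Var Val) λ q →
      p ∈ A × q ∈ A × proj₁ p ≡ proj₁ q × ¬ (toℕ (proj₂ p) ≡ toℕ (proj₂ q))

  inAnte : Ante → Var → Bool
  inAnte A V = any (λ p → does (proj₁ p ≟ V)) A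

  intervene : SysFun → Ante → SysFun
  intervene F A = record F { en = λ V → en F V ∧ not (inAnte A V) }

  -- t = s^F_{X=x}  (the recursive defining clauses; for recursive F and
  -- consistent A they determine t uniquely)
  IsIntv : SysFun → Ante → Asg → Asg → Set
  IsIntv F A s t =
    (∀ p → p ∈ A → t (proj₁ p) ≡ proj₂ p) ×
    (∀ V → inAnte A V ≡ false → en F V ≡ false → t V ≡ s V) ×
    (∀ V → inAnte A V ≡ false → en F V ≡ true  → t V ≡ fn F V t)

  infixr 6 _⊓_
  infixr 5 _⊔_
  infixr 4 _□→_
  data Fml : Set where
    eqA  : (X : Var) → Val X → Fml
    dep  : Var → Fml
    neg  : Fml → Fml
    _⊓_  : Fml → Fml → Fml
    ⋀    : List Fml → Fml
    _⊔_  : Fml → Fml → Fml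
    _□→_ : Ante → Fml → Fml

  -- causal teams (T⁻, F), T⁻ given as a list (duplicates irrelevant)
  CTeam : Set
  CTeam = List Asg × SysFun

  mutual
    _⊨c_ : CTeam → Fml → Set
    (L , F) ⊨c eqA X x = ∀ s → s ∈ L → s X ≡ x
    (L , F) ⊨c dep X   = ∀ s t → s ∈ L → t ∈ L → s X ≡ t X
    (L , F) ⊨c neg α   = ∀ s → s ∈ L → ¬ (([ s ] , F) ⊨c α)
    (L , F) ⊨c (φ ⊓ ψ) = ((L , F) ⊨c φ) × ((L , F) ⊨c ψ)
    (L , F) ⊨c ⋀ φs    = AllC (L , F) φs
    (L , F) ⊨c (φ ⊔ ψ) =
      Σ (List Asg) λ L₁ → Σ (List Asg) λ L₂ →
        (∀ s → s ∈ L₁ → s ∈ L) × (∀ s → s ∈ L₂ → s ∈ L) ×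
        (∀ s → s ∈ L → s ∈ L₁ ⊎ s ∈ L₂) ×
        ((L₁ , F) ⊨c φ) × ((L₂ , F) ⊨c ψ)
    (L , F) ⊨c (A □→ φ) =
      Inconsistent A ⊎
      (∀ L′ → Pointwise (IsIntv F A) L L′ → (L′ , intervene F A) ⊨c φ)

    AllC : CTeam → List Fml → Set
    AllC T [] = ⊤
    AllC T (φ ∷ φs) = (T ⊨c φ) × AllC T φs

  -- generalized causal teams: sets of pairs (s , F), given as lists
  GTeam : Set
  GTeam = List (Asg × SysFun)

  IsIntvG : Ante → Asg × SysFun → Asg × SysFun → Set
  IsIntvG A p q = IsIntv (proj₂ p) A (proj₁ p) (proj₁ q) × proj₂ q ≡ intervene (proj₂ p) A

  mutual
    _⊨g_ : GTeam → Fml → Set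
    L ⊨g eqA X x = ∀ p → p ∈ L → proj₁ p X ≡ x
    L ⊨g dep X   = ∀ p q → p ∈ L → q ∈ L → proj₁ p X ≡ proj₁ q X
    L ⊨g neg α   = ∀ p → p ∈ L → ¬ ([ p ] ⊨g α)
    L ⊨g (φ ⊓ ψ) = (L ⊨g φ) × (L ⊨g ψ)
    L ⊨g ⋀ φs    = AllG L φs
    L ⊨g (φ ⊔ ψ) =
      Σ GTeam λ L₁ → Σ GTeam λ L₂ →
        (∀ p → p ∈ L₁ → p ∈ L) × (∀ p → p ∈ L₂ → p ∈ L) ×
        (∀ p → p ∈ L → p ∈ L₁ ⊎ p ∈ L₂) ×
        (L₁ ⊨g φ) × (L₂ ⊨g ψ)
    L ⊨g (A □→ φ) =
      Inconsistent A ⊎ (∀ L′ → Pointwise (IsIntvG A) L L′ → L′ ⊨g φ)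

    AllG : GTeam → List Fml → Set
    AllG T [] = ⊤
    AllG T (φ ∷ φs) = (T ⊨g φ) × AllG T φs

  SimV : SysFun → SysFun → Var → Set
  SimV F G V = ∀ (s t : Asg) →
    (∀ W → T (pa F V W) → T (pa G V W) → s W ≡ t W) → fn F V s ≡ fn G V t

  Const : SysFun → Var → Set
  Const F V = ∀ (s t : Asg) → fn F V s ≡ fn F V t

  NonConst : SysFun → Var → Set
  NonConst F V = T (en F V) × ¬ Const F V

  _∼_ : SysFun → SysFun → Set
  F ∼ G = (∀ V → (NonConst F V → NonConst G V) × (NonConst G V → NonConst F V)) ×
          (∀ V → NonConst F V → SimV F G V)

  _≈_ : Asg × SysFun → Asg × SysFun → Set
  p ≈ q = (proj₁ p ≐ proj₁ q) × (proj₂ p ∼ proj₂ q)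

  allVars : List Var
  allVars = allFin (suc n)

  allAsg : List Asg
  allAsg = allDep (suc n) (λ X → suc (r X))

  -- Ran(W_V), W_V = Dom \ {V}: each w is represented by the unique
  -- assignment extending it with value zero at V
  ranW : Var → List Asg
  ranW V = filter (λ s → s V ≟ zero) allAsg

  anteW : Var → Asg → Ante
  anteW V w = map (λ W → (W , w W)) (filter (λ W → ¬? (W ≟ V)) allVars)

  χ : Fml
  χ = ⋀ (map (λ V → ⋀ (map (λ w → anteW V w □→ dep V) (ranW V))) allVars)
      ⊓ ⋀ (map dep allVars)

  ⊥F : Fml
  ⊥F = eqA zero zero ⊓ neg (eqA zero zero)

  χ_ : ℕ → Fml
  χ_ zero          = ⊥F
  χ_ (suc zero)    = χ
  χ_ (suc (suc k)) = χ ⊔ χ_ (suc k)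

-- χ says that a team is homogeneous up to ≈. The constancy atoms =(V) force all assignments to
-- coincide. After the intervention W_V = w, which fixes every variable but V, the value of V is
-- F_V(w) if V is endogenous and s(V) otherwise; so the counterfactuals W_V = w □→ =(V) say that all
-- members have the same "responses". For compatible pairs, equal assignments plus equal responses
-- is exactly similarity: a constant endogenous F_V responds with its constant value, which
-- compatibility makes equal to s(V), just like an exogenous V. Hence χ_k, a k-fold team
-- disjunction of χ, holds iff the team splits into at most k homogeneous parts, i.e. iff it can be
-- covered by at most k elements up to ≈, which by pigeonhole means at most k classes.

module Submission where

open import Defs
open import Level using (0ℓ)
open import Data.Nat using (ℕ; zero; suc; _≤_; z≤n; s≤s)
open import Data.Nat.Properties using (≤-trans; +-mono-≤)
open import Data.Fin using (Fin; zero; suc; _≟_; toℕ)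
open import Data.Fin.Properties using (all?)
open import Data.Bool using (true; false; T; if_then_else_)
open import Data.Bool.Properties using (T-≡)
open import Data.List using (List; []; _∷_; [_]; length; map; filter; deduplicate; _++_)
open import Data.List.Properties using (length-++; length-removeAt′)
open import Data.List.Membership.Propositional using (_∈_; _∉_; find; lose)
open import Data.List.Membership.Propositional.Properties
  using (∈-map⁺; ∈-map⁻; ∈-filter⁺; ∈-filter⁻; ∈-concatMap⁺; ∈-allFin; ∈-deduplicate⁻)
import Data.List.Membership.Setoid.Properties as Setoidₘ
open import Data.List.Relation.Unary.All as All using (All)
open import Data.List.Relation.Unary.Any as Any using (Any; here; there; _─_)
open import Data.List.Relation.Unary.Any.Properties using (++⁺ˡ; ++⁺ʳ; any⁺; any⁻)
open import Data.List.Relation.Unary.AllPairs using (AllPairs; _∷_)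
open import Data.List.Relation.Unary.Unique.DecSetoid.Properties using (deduplicate-!)
open import Data.List.Relation.Binary.Pointwise using (Pointwise; []; _∷_)
open import Data.List.Relation.Binary.Subset.Propositional.Properties using (All-resp-⊇)
open import Data.Product using (Σ; _×_; _,_; proj₁; proj₂; ∃)
open import Data.Sum using (_⊎_; inj₁; inj₂)
open import Data.Unit using (tt)
open import Data.Empty using (⊥; ⊥-elim)
open import Function using (_∘_; case_of_)
open import Function.Bundles using (_⇔_; mk⇔; Equivalence)
open import Function.Properties.Equivalence using (⇔-setoid)
  renaming (refl to ⇔-refl; sym to ⇔-sym; trans to ⇔-trans)
open import Relation.Nullary using (¬_; Dec; yes; no; ¬?)
open import Relation.Nullary.Decidable using (_×-dec_; _→-dec_; T?; map′; toWitness; isYes≗does; dec-true)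
open import Relation.Binary.Bundles using (DecSetoid)
open import Relation.Binary.PropositionalEquality
  using (_≡_; _≢_; refl; sym; trans; cong; subst; module ≡-Reasoning)
import Relation.Binary.Reasoning.Setoid as ≈-Reasoning

≡true⇒T : ∀ {b} → b ≡ true → T b
≡true⇒T = Equivalence.from T-≡

¬T⇒≡false : ∀ {b} → ¬ T b → b ≡ false
¬T⇒≡false {false} _ = refl
¬T⇒≡false {true} ¬t = ⊥-elim (¬t tt)

allDep-complete : (m : ℕ) (c : Fin m → ℕ) (f : (i : Fin m) → Fin (c i)) →
  ∃ λ g → g ∈ allDep m c × (∀ i → g i ≡ f i)
allDep-complete zero c f = _ , here refl , λ ()
allDep-complete (suc m) c f with allDep-complete m (c ∘ suc) (f ∘ suc)
... | g , g∈ , g≗f =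
  consDep {m} {c} (f zero) g ,
  ∈-concatMap⁺ (λ x → map (consDep {m} {c} x) (allDep m (c ∘ suc)))
    (Any.map (λ { refl → ∈-map⁺ (consDep {m} {c} (f zero)) g∈ }) (∈-allFin (f zero))) ,
  λ { zero → refl ; (suc i) → g≗f i }

Pointwise-∈ʳ : {A B : Set} {R : A → B → Set} {as : List A} {bs : List B} →
               Pointwise R as bs → ∀ {b} → b ∈ bs → ∃ λ a → a ∈ as × R a b
Pointwise-∈ʳ (r ∷ _)  (here refl) = _ , here refl , r
Pointwise-∈ʳ (_ ∷ rs) (there b∈) = let a , a∈ , r = Pointwise-∈ʳ rs b∈ in a , there a∈ , r

Any-─ : {A : Set} {P Q : A → Set} {cs : List A} → Any Q cs → (p : Any P cs) →
        (∀ {c} → P c → Q c → ⊥) → Any Q (cs ─ p)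
Any-─ (here qc)  (here pc)  disjoint = ⊥-elim (disjoint pc qc)
Any-─ (here qc)  (there p)  disjoint = here qc
Any-─ (there q)  (here pc)  disjoint = q
Any-─ (there q)  (there p)  disjoint = there (Any-─ q p disjoint)

-- The team semantics of ⊔ in Defs, verbatim.
UnionOf : {A : Set} → (List A → Set) → (List A → Set) → List A → Set
UnionOf {A} P Q L =
  Σ (List A) λ L₁ → Σ (List A) λ L₂ →
    (∀ a → a ∈ L₁ → a ∈ L) × (∀ a → a ∈ L₂ → a ∈ L) ×
    (∀ a → a ∈ L → a ∈ L₁ ⊎ a ∈ L₂) × P L₁ × Q L₂

UnionOf-cong : {A : Set} {P P′ Q Q′ : List A → Set} {L : List A} →
  (∀ L′ → (∀ a → a ∈ L′ → a ∈ L) → P L′ ⇔ P′ L′) →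
  (∀ L′ → (∀ a → a ∈ L′ → a ∈ L) → Q L′ ⇔ Q′ L′) →
  UnionOf P Q L ⇔ UnionOf P′ Q′ L
UnionOf-cong P⇔P′ Q⇔Q′ = mk⇔
  (λ (L₁ , L₂ , ⊆₁ , ⊆₂ , ∪ , p , q) →
     L₁ , L₂ , ⊆₁ , ⊆₂ , ∪ , to (P⇔P′ L₁ ⊆₁) p , to (Q⇔Q′ L₂ ⊆₂) q)
  (λ (L₁ , L₂ , ⊆₁ , ⊆₂ , ∪ , p , q) →
     L₁ , L₂ , ⊆₁ , ⊆₂ , ∪ , from (P⇔P′ L₁ ⊆₁) p , from (Q⇔Q′ L₂ ⊆₂) q)
  where open Equivalence

module Classes (S : DecSetoid 0ℓ 0ℓ) where
  open DecSetoid S using (_≈_; _≉_; setoid)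
    renaming (Carrier to A; _≟_ to _≈?_; refl to ≈-refl; sym to ≈-sym; trans to ≈-trans)

  Homogeneous : List A → Set
  Homogeneous L = ∀ a b → a ∈ L → b ∈ L → a ≈ b

  Covers : List A → List A → Set
  Covers cs L = ∀ a → a ∈ L → Any (a ≈_) cs

  CoveredByAtMost : ℕ → List A → Set
  CoveredByAtMost k L = ∃ λ cs → length cs ≤ k × Covers cs L

  quotientSize-deduplicate : ∀ L → QuotientSize _≈_ L (length (deduplicate _≈?_ L))
  quotientSize-deduplicate L =
    deduplicate _≈?_ L ,
    (λ _ → ∈-deduplicate⁻ _≈?_ L) ,
    deduplicate-! S L ,
    (λ a a∈L → Setoidₘ.∈-deduplicate⁺ setoid _≈?_ (λ z≈y x≈y → ≈-trans x≈y (≈-sym z≈y))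
                 (Any.map (λ { refl → ≈-refl }) a∈L)) ,
    refl

  -- Pigeonhole: the element covering the first representative covers no other one, so it can be
  -- removed from the cover before recursing.
  pairwiseInequivalent-length-≤ : ∀ {reps} cs → AllPairs _≉_ reps → Covers cs reps → length reps ≤ length cs
  pairwiseInequivalent-length-≤ {[]}       cs _              _   = z≤n
  pairwiseInequivalent-length-≤ {r ∷ reps} cs (r≉reps ∷ ≉s) cov =
    subst (suc (length reps) ≤_) (sym (length-removeAt′ cs (Any.index r∈cs)))
      (s≤s (pairwiseInequivalent-length-≤ (cs ─ r∈cs) ≉s λ a a∈ →
        Any-─ (cov a (there a∈)) r∈cs λ r≈c a≈c → All.lookup r≉reps a∈ (≈-trans r≈c (≈-sym a≈c))))
    where r∈cs = cov r (here refl)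

  quotientSize≤⇔coveredByAtMost : ∀ k L → (∃ λ m → QuotientSize _≈_ L m × m ≤ k) ⇔ CoveredByAtMost k L
  quotientSize≤⇔coveredByAtMost k L = mk⇔
    (λ { (m , (reps , _ , _ , cov , refl) , m≤k) → reps , m≤k , cov })
    (λ { (cs , cs≤k , cov) →
      let q@(reps , reps⊆L , ≉s , _ , _) = quotientSize-deduplicate L in
      length reps , q ,
      ≤-trans (pairwiseInequivalent-length-≤ cs ≉s (λ a a∈ → cov a (reps⊆L a a∈))) cs≤k })

  coveredByAtMost-zero⇔empty : ∀ L → CoveredByAtMost 0 L ⇔ (∀ a → a ∉ L)
  coveredByAtMost-zero⇔empty L = mk⇔
    (λ { ([] , _ , cov) a a∈ → case cov a a∈ of λ () })
    (λ empty → [] , z≤n , λ a a∈ → ⊥-elim (empty a a∈))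

  coveredByAtMost-one⇔homogeneous : ∀ L → CoveredByAtMost 1 L ⇔ Homogeneous L
  coveredByAtMost-one⇔homogeneous L = mk⇔ to (from L)
    where
      to : CoveredByAtMost 1 L → Homogeneous L
      to ([] , _ , cov) a _ a∈ _ = case cov a a∈ of λ ()
      to (c ∷ [] , _ , cov) a b a∈ b∈ with cov a a∈ | cov b b∈
      ... | here a≈c | here b≈c = ≈-trans a≈c (≈-sym b≈c)
      to (_ ∷ _ ∷ _ , s≤s () , _)
      from : ∀ L′ → Homogeneous L′ → CoveredByAtMost 1 L′
      from []      _   = [] , z≤n , λ _ ()
      from (c ∷ _) hom = [ c ] , s≤s z≤n , λ a a∈ → here (hom a c a∈ (here refl))

  union⇔coveredByAtMost-suc : ∀ k L →
    UnionOf (CoveredByAtMost 1) (CoveredByAtMost k) L ⇔ CoveredByAtMost (suc k) L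
  union⇔coveredByAtMost-suc k L = mk⇔ union split
    where
      union : UnionOf (CoveredByAtMost 1) (CoveredByAtMost k) L → CoveredByAtMost (suc k) L
      union (L₁ , L₂ , _ , _ , ∪ , (cs₁ , cs₁≤1 , cov₁) , (cs₂ , cs₂≤k , cov₂)) =
        cs₁ ++ cs₂ , subst (_≤ suc k) (sym (length-++ cs₁)) (+-mono-≤ cs₁≤1 cs₂≤k) , cov
        where
          cov : Covers (cs₁ ++ cs₂) L
          cov a a∈ with ∪ a a∈
          ... | inj₁ a∈₁ = ++⁺ˡ (cov₁ a a∈₁)
          ... | inj₂ a∈₂ = ++⁺ʳ cs₁ (cov₂ a a∈₂)
      split : CoveredByAtMost (suc k) L → UnionOf (CoveredByAtMost 1) (CoveredByAtMost k) L
      split ([] , _ , cov) = [] , L , (λ _ ()) , (λ _ a∈ → a∈) , (λ _ → inj₂) ,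
                             ([] , z≤n , λ _ ()) , ([] , z≤n , cov)
      split (c ∷ cs , s≤s cs≤k , cov) =
        filter (_≈? c) L , filter (¬? ∘ (_≈? c)) L ,
        (λ _ → proj₁ ∘ ∈-filter⁻ (_≈? c) {xs = L}) ,
        (λ _ → proj₁ ∘ ∈-filter⁻ (¬? ∘ (_≈? c)) {xs = L}) , ∪ ,
        ([ c ] , s≤s z≤n , λ a a∈ → here (proj₂ (∈-filter⁻ (_≈? c) {xs = L} a∈))) ,
        (cs , cs≤k , cov′)
        where
          ∪ : ∀ a → a ∈ L → a ∈ filter (_≈? c) L ⊎ a ∈ filter (¬? ∘ (_≈? c)) L
          ∪ a a∈ with a ≈? c
          ... | yes a≈c = inj₁ (∈-filter⁺ (_≈? c) a∈ a≈c)
          ... | no  a≉c = inj₂ (∈-filter⁺ (¬? ∘ (_≈? c)) a∈ a≉c)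
          cov′ : Covers cs (filter (¬? ∘ (_≈? c)) L)
          cov′ a a∈ with ∈-filter⁻ (¬? ∘ (_≈? c)) {xs = L} a∈
          ... | a∈L , a≉c with cov a a∈L
          ...   | here a≈c  = ⊥-elim (a≉c a≈c)
          ...   | there a∈cs = a∈cs

  module Counting (Good : A → Set) (Sat : ℕ → List A → Set)
    (sat-zero : ∀ L → Sat 0 L ⇔ (∀ a → a ∉ L))
    (sat-one  : ∀ L → All Good L → Sat 1 L ⇔ Homogeneous L)
    (sat-suc  : ∀ k L → Sat (suc (suc k)) L ⇔ UnionOf (Sat 1) (Sat (suc k)) L) where

    sat⇔coveredByAtMost : ∀ k L → All Good L → Sat k L ⇔ CoveredByAtMost k L
    sat⇔coveredByAtMost zero L _ = ⇔-trans (sat-zero L) (⇔-sym (coveredByAtMost-zero⇔empty L))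
    sat⇔coveredByAtMost (suc zero) L good = ⇔-trans (sat-one L good) (⇔-sym (coveredByAtMost-one⇔homogeneous L))
    sat⇔coveredByAtMost (suc (suc k)) L good = begin
      Sat (suc (suc k)) L                                      ≈⟨ sat-suc k L ⟩
      UnionOf (Sat 1) (Sat (suc k)) L
        ≈⟨ UnionOf-cong (λ L′ ⊆L → sat⇔coveredByAtMost 1 L′ (good-on ⊆L))
                        (λ L′ ⊆L → sat⇔coveredByAtMost (suc k) L′ (good-on ⊆L)) ⟩
      UnionOf (CoveredByAtMost 1) (CoveredByAtMost (suc k)) L  ≈⟨ union⇔coveredByAtMost-suc (suc k) L ⟩
      CoveredByAtMost (suc (suc k)) L                          ∎
      where
        open ≈-Reasoning (⇔-setoid 0ℓ)
        good-on : ∀ {L′} → (∀ a → a ∈ L′ → a ∈ L) → All Good L′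
        good-on L′⊆L = All-resp-⊇ (λ {a} → L′⊆L a) good

open Classes using (Homogeneous; module Counting; quotientSize≤⇔coveredByAtMost)

module Signature (n : ℕ) (r : Fin (suc n) → ℕ) where
  open Sig n r

  allAsg-complete : ∀ s → ∃ λ a → a ∈ allAsg × a ≐ s
  allAsg-complete = allDep-complete (suc n) (λ X → suc (r X))

  ∀-Asg? : {P : Asg → Set} → (∀ {s t} → s ≐ t → P s → P t) →
           (∀ s → Dec (P s)) → Dec (∀ s → P s)
  ∀-Asg? resp P? = map′
    (λ all s → let a , a∈ , a≐s = allAsg-complete s in resp a≐s (All.lookup all a∈))
    (λ all → All.tabulate λ {a} _ → all a)
    (All.all? P? allAsg)

  ≐? : ∀ s t → Dec (s ≐ t)
  ≐? s t = all? (λ X → s X ≟ t X)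

  fn-cong : ∀ F V {s t} → s ≐ t → fn F V s ≡ fn F V t
  fn-cong F V s≐t = fn-local F V _ _ (λ W _ → s≐t W)

  pa-irreflexive : ∀ F {V W} → T (pa F V W) → W ≢ V
  pa-irreflexive F {V} p refl = subst T (pa-irrefl F V) p

  Const? : ∀ F V → Dec (Const F V)
  Const? F V = ∀-Asg? (λ s≐s′ const t → trans (sym (fn-cong F V s≐s′)) (const t))
    λ s → ∀-Asg? (λ t≐t′ eq → trans eq (fn-cong F V t≐t′)) λ t → fn F V s ≟ fn F V t

  NonConst? : ∀ F V → Dec (NonConst F V)
  NonConst? F V = T? (en F V) ×-dec ¬? (Const? F V)

  SimV? : ∀ F G V → Dec (SimV F G V)
  SimV? F G V = ∀-Asg?
    (λ s≐s′ sim t agree → trans (sym (fn-cong F V s≐s′)) (sim t λ W p q → trans (s≐s′ W) (agree W p q)))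
    λ s → ∀-Asg?
      (λ t≐t′ sim agree → trans (sim λ W p q → trans (agree W p q) (sym (t≐t′ W))) (fn-cong G V t≐t′))
      λ t → all? (λ W → T? (pa F V W) →-dec T? (pa G V W) →-dec s W ≟ t W) →-dec fn F V s ≟ fn G V t

  ∼? : ∀ F G → Dec (F ∼ G)
  ∼? F G = all? (λ V → (NonConst? F V →-dec NonConst? G V) ×-dec (NonConst? G V →-dec NonConst? F V))
       ×-dec all? (λ V → NonConst? F V →-dec SimV? F G V)

  merge : SysFun → Var → Asg → Asg → Asg
  merge F V s t W = if pa F V W then s W else t W

  merge-parent : ∀ F V s t W → T (pa F V W) → merge F V s t W ≡ s W
  merge-parent F V s t W p with pa F V W
  ... | true = refl

  merge-agree : ∀ F G V s t → (∀ W → T (pa F V W) → T (pa G V W) → s W ≡ t W) →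
                ∀ W → T (pa G V W) → merge F V s t W ≡ t W
  merge-agree F G V s t agree W q with pa F V W | agree W
  ... | true  | agree-W = agree-W tt q
  ... | false | _       = refl

  ∼-refl : ∀ {F} → F ∼ F
  ∼-refl {F} = (λ V → (λ nc → nc) , (λ nc → nc)) , λ V _ s t agree → fn-local F V s t λ W p → agree W p p

  ∼-sym : ∀ {F G} → F ∼ G → G ∼ F
  ∼-sym (F⇔G , sim) =
    (λ V → proj₂ (F⇔G V) , proj₁ (F⇔G V)) ,
    λ V nc s t agree → sym (sim V (proj₂ (F⇔G V) nc) t s λ W p q → sym (agree W q p))

  ∼-trans : ∀ {F G H} → F ∼ G → G ∼ H → F ∼ H
  ∼-trans {F} {G} {H} (F⇔G , simFG) (G⇔H , simGH) =
    (λ V → proj₁ (G⇔H V) ∘ proj₁ (F⇔G V) , proj₂ (F⇔G V) ∘ proj₂ (G⇔H V)) ,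
    λ V nc s t agree →
      let u = merge F V s t in
      trans (simFG V nc s u λ W p _ → sym (merge-parent F V s t W p))
            (simGH V (proj₁ (F⇔G V) nc) u t λ W _ q → merge-agree F H V s t agree W q)

  ≈-decSetoid : DecSetoid 0ℓ 0ℓ
  ≈-decSetoid = record
    { Carrier = Asg × SysFun
    ; _≈_ = _≈_
    ; isDecEquivalence = record
      { isEquivalence = record
        { refl = λ {(s , F)} → (λ X → refl) , ∼-refl {F}
        ; sym = λ {(s , F)} {(t , G)} (s≐t , F∼G) → (λ X → sym (s≐t X)) , ∼-sym {F} {G} F∼G
        ; trans = λ {(s , F)} {(t , G)} {(u , H)} (s≐t , F∼G) (t≐u , G∼H) →
                    (λ X → trans (s≐t X) (t≐u X)) , ∼-trans {F} {G} {H} F∼G G∼H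
        }
      ; _≟_ = λ (s , F) (t , G) → ≐? s t ×-dec ∼? F G
      }
    }

  ≐-decSetoid : DecSetoid 0ℓ 0ℓ
  ≐-decSetoid = record
    { Carrier = Asg
    ; _≈_ = _≐_
    ; isDecEquivalence = record
      { isEquivalence = record
        { refl = λ X → refl
        ; sym = λ s≐t X → sym (s≐t X)
        ; trans = λ s≐t t≐u X → trans (s≐t X) (t≐u X)
        }
      ; _≟_ = ≐?
      }
    }

  -- response F s V w is s^F_{W_V = w}(V); the intervention fixes every variable except V.
  response : SysFun → Asg → (V : Var) → Asg → Val V
  response F s V w = if en F V then fn F V w else s V

  response-en : ∀ F s V → T (en F V) → ∀ w → response F s V w ≡ fn F V w
  response-en F s V enV w with en F V
  ... | true = refl

  response-ex : ∀ F s V → en F V ≡ false → ∀ w → response F s V w ≡ s V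
  response-ex F s V exV w rewrite exV = refl

  response-local : ∀ F s V {w w′} → (∀ W → W ≢ V → w W ≡ w′ W) → response F s V w ≡ response F s V w′
  response-local F s V w≐w′ with en F V
  ... | true  = fn-local F V _ _ λ W p → w≐w′ W (pa-irreflexive F p)
  ... | false = refl

  response-state : ∀ F V w s s′ → s V ≡ s′ V → response F s V w ≡ response F s′ V w
  response-state F V w s s′ = cong (λ x → if en F V then fn F V w else x)

  response-compatible : ∀ F s V → Compatible F s → ¬ NonConst F V → ∀ w → response F s V w ≡ s V
  response-compatible F s V compat ¬nc w with en F V in e
  ... | false = refl
  ... | true with Const? F V
  ...   | yes const = trans (const w s) (sym (compat V (≡true⇒T e)))
  ...   | no ¬const = ⊥-elim (¬nc (tt , ¬const))

  responseOf : Asg × SysFun → (V : Var) → Asg → Val V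
  responseOf (s , F) = response F s

  SameResponses : Asg × SysFun → Asg × SysFun → Set
  SameResponses p q = ∀ V w → responseOf p V w ≡ responseOf q V w

  module _ {s t : Asg} {F G : SysFun} (same : SameResponses (s , F) (t , G)) where

    fn≡response : ∀ V → T (en F V) → ∀ w → fn F V w ≡ response G t V w
    fn≡response V enF w = trans (sym (response-en F s V enF w)) (same V w)

    nonConst-transfer : ∀ {V} → NonConst F V → NonConst G V
    nonConst-transfer {V} (enF , ¬constF) = by-cases (en G V) refl
      where
        fn≡ = fn≡response V enF
        by-cases : ∀ b → en G V ≡ b → NonConst G V
        by-cases false exG = ⊥-elim (¬constF λ a b →
          trans (fn≡ a) (trans (response-ex G t V exG a) (sym (trans (fn≡ b) (response-ex G t V exG b)))))
        by-cases true enG = ≡true⇒T enG , λ constG → ¬constF λ a b →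
          trans (fn≡ a) (trans (response-en G t V (≡true⇒T enG) a)
            (trans (constG a b) (sym (trans (fn≡ b) (response-en G t V (≡true⇒T enG) b)))))

    simV : ∀ V → NonConst F V → SimV F G V
    simV V nc a b agree = begin
      fn F V a          ≡⟨ fn-local F V a u (λ W p → sym (merge-parent F V a b W p)) ⟩
      fn F V u          ≡⟨ fn≡response V (proj₁ nc) u ⟩
      response G t V u  ≡⟨ response-en G t V (proj₁ (nonConst-transfer nc)) u ⟩
      fn G V u          ≡⟨ fn-local G V u b (merge-agree F G V a b agree) ⟩
      fn G V b          ∎
      where
        open ≡-Reasoning
        u = merge F V a b

  sameResponses⇒∼ : ∀ {s t F G} → SameResponses (s , F) (t , G) → F ∼ G
  sameResponses⇒∼ {s} {t} {F} {G} same =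
    (λ V → nonConst-transfer {s} {t} {F} {G} same , nonConst-transfer {t} {s} {G} {F} λ V w → sym (same V w)) ,
    simV {s} {t} {F} {G} same

  ∼⇒sameResponses : ∀ {s t F G} → Compatible F s → Compatible G t → s ≐ t → F ∼ G →
                    SameResponses (s , F) (t , G)
  ∼⇒sameResponses {s} {t} {F} {G} compatF compatG s≐t (F⇔G , sim) V w with NonConst? F V
  ... | yes nc = begin
    response F s V w  ≡⟨ response-en F s V (proj₁ nc) w ⟩
    fn F V w          ≡⟨ sim V nc w w (λ _ _ _ → refl) ⟩
    fn G V w          ≡⟨ sym (response-en G t V (proj₁ (proj₁ (F⇔G V) nc)) w) ⟩
    response G t V w  ∎
    where open ≡-Reasoning
  ... | no ¬nc = begin
    response F s V w  ≡⟨ response-compatible F s V compatF ¬nc w ⟩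
    s V               ≡⟨ s≐t V ⟩
    t V               ≡⟨ sym (response-compatible G t V compatG (¬nc ∘ proj₂ (F⇔G V)) w) ⟩
    response G t V w  ∎
    where open ≡-Reasoning

  ≈⇔≐×sameResponses : ∀ ((s , F) (t , G) : Asg × SysFun) → Compatible F s → Compatible G t →
                      (s , F) ≈ (t , G) ⇔ (s ≐ t × SameResponses (s , F) (t , G))
  ≈⇔≐×sameResponses (s , F) (t , G) compatF compatG = mk⇔
    (λ (s≐t , F∼G) → s≐t , ∼⇒sameResponses {s} {t} {F} {G} compatF compatG s≐t F∼G)
    (λ (s≐t , same) → s≐t , sameResponses⇒∼ {s} {t} {F} {G} same)

  anteW-∈⁻ : ∀ V w {p} → p ∈ anteW V w → proj₁ p ≢ V × proj₂ p ≡ w (proj₁ p)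
  anteW-∈⁻ V w p∈ with ∈-map⁻ (λ W → W , w W) p∈
  ... | W , W∈ , refl = proj₂ (∈-filter⁻ (λ W → ¬? (W ≟ V)) {xs = allVars} W∈) , refl

  anteW-∈⁺ : ∀ V w {W} → W ≢ V → (W , w W) ∈ anteW V w
  anteW-∈⁺ V w {W} W≢V = ∈-map⁺ (λ W → W , w W) (∈-filter⁺ (λ W → ¬? (W ≟ V)) (∈-allFin W) W≢V)

  anteW-consistent : ∀ V w → ¬ Inconsistent (anteW V w)
  anteW-consistent V w ((W , x) , (W , x′) , p∈ , q∈ , refl , x≢x′) =
    x≢x′ (cong toℕ (trans (proj₂ (anteW-∈⁻ V w p∈)) (sym (proj₂ (anteW-∈⁻ V w q∈)))))

  inAnte-anteW-self : ∀ V w → inAnte (anteW V w) V ≡ false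
  inAnte-anteW-self V w = ¬T⇒≡false λ inV →
    let (W , _) , p∈ , W≟V = find (any⁻ _ (anteW V w) inV) in
    proj₁ (anteW-∈⁻ V w p∈) (toWitness (subst T (sym (isYes≗does (W ≟ V))) W≟V))

  inAnte-anteW-other : ∀ V w {W} → W ≢ V → inAnte (anteW V w) W ≡ true
  inAnte-anteW-other V w {W} W≢V =
    Equivalence.to T-≡ (any⁺ _ (lose (anteW-∈⁺ V w W≢V) (≡true⇒T (dec-true (W ≟ W) refl))))

  notInAnte-anteW : ∀ V w {W} → inAnte (anteW V w) W ≡ false → W ≡ V
  notInAnte-anteW V w {W} notIn with W ≟ V
  ... | yes W≡V = W≡V
  ... | no  W≢V with () ← trans (sym (inAnte-anteW-other V w W≢V)) notIn

  isIntv-fixes : ∀ {F V w s t} → IsIntv F (anteW V w) s t → ∀ W → W ≢ V → t W ≡ w W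
  isIntv-fixes {V = V} {w} (fixes , _) W W≢V = fixes (W , w W) (anteW-∈⁺ V w W≢V)

  isIntv-response : ∀ F V w {s t} → IsIntv F (anteW V w) s t → t V ≡ response F s V w
  isIntv-response F V w {s} {t} iv@(_ , exo , endo) with en F V in e
  ... | true  = begin
    t V       ≡⟨ endo V (inAnte-anteW-self V w) e ⟩
    fn F V t  ≡⟨ fn-local F V t w (λ W p → isIntv-fixes {F} iv W (pa-irreflexive F p)) ⟩
    fn F V w  ∎
    where open ≡-Reasoning
  ... | false = exo V (inAnte-anteW-self V w) e

  _[_≔_] : Asg → (V : Var) → Val V → Asg
  (w [ V ≔ v ]) W with W ≟ V
  ... | yes refl = v
  ... | no  _    = w W

  update-same : ∀ w V v → (w [ V ≔ v ]) V ≡ v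
  update-same w V v with V ≟ V
  ... | yes refl = refl
  ... | no  V≢V  = ⊥-elim (V≢V refl)

  update-other : ∀ w V v {W} → W ≢ V → (w [ V ≔ v ]) W ≡ w W
  update-other w V v {W} W≢V with W ≟ V
  ... | yes W≡V = ⊥-elim (W≢V W≡V)
  ... | no  _   = refl

  intervention : SysFun → Asg → (V : Var) → Asg → Asg
  intervention F s V w = w [ V ≔ response F s V w ]

  intervention-isIntv : ∀ F s V w → IsIntv F (anteW V w) s (intervention F s V w)
  intervention-isIntv F s V w = fixes , exo , endo
    where
      t = intervention F s V w
      fixes : ∀ p → p ∈ anteW V w → t (proj₁ p) ≡ proj₂ p
      fixes p p∈ = let W≢V , p≡w = anteW-∈⁻ V w p∈ in
        trans (update-other w V _ W≢V) (sym p≡w)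
      exo : ∀ W → inAnte (anteW V w) W ≡ false → en F W ≡ false → t W ≡ s W
      exo W notIn exW with refl ← notInAnte-anteW V w notIn =
        trans (update-same w V _) (response-ex F s V exW w)
      endo : ∀ W → inAnte (anteW V w) W ≡ false → en F W ≡ true → t W ≡ fn F W t
      endo W notIn enW with refl ← notInAnte-anteW V w notIn =
        trans (update-same w V _) (trans (response-en F s V (≡true⇒T enW) w)
          (fn-local F V w t λ U p → sym (update-other w V _ (pa-irreflexive F p))))

  ranW-representative : ∀ V w → ∃ λ w′ → w′ ∈ ranW V × (∀ W → W ≢ V → w′ W ≡ w W)
  ranW-representative V w =
    let w′ , w′∈ , w′≐ = allAsg-complete (w [ V ≔ zero ]) in
    w′ , ∈-filter⁺ (λ s → s V ≟ zero) w′∈ (trans (w′≐ V) (update-same w V zero)) ,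
    λ W W≢V → trans (w′≐ W) (update-other w V zero W≢V)

  intervenedPair : Var → Asg → Asg × SysFun → Asg × SysFun
  intervenedPair V w (s , F) = intervention F s V w , intervene F (anteW V w)

  intervenedTeam-isIntv : ∀ V w L → Pointwise (IsIntvG (anteW V w)) L (map (intervenedPair V w) L)
  intervenedTeam-isIntv V w [] = []
  intervenedTeam-isIntv V w ((s , F) ∷ L) = (intervention-isIntv F s V w , refl) ∷ intervenedTeam-isIntv V w L

  ⊨g-⋀-map⇔ : {B : Set} (f : B → Fml) (xs : List B) (L : GTeam) →
              (L ⊨g ⋀ (map f xs)) ⇔ (∀ x → x ∈ xs → L ⊨g f x)
  ⊨g-⋀-map⇔ f [] L = mk⇔ (λ _ _ ()) (λ _ → tt)
  ⊨g-⋀-map⇔ f (y ∷ ys) L = mk⇔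
    (λ (fy , rest) → λ { x (here refl) → fy ; x (there x∈) → Equivalence.to (⊨g-⋀-map⇔ f ys L) rest x x∈ })
    (λ all → all y (here refl) , Equivalence.from (⊨g-⋀-map⇔ f ys L) (λ x x∈ → all x (there x∈)))

  ⊨g-□→dep⇔ : ∀ V w L → (L ⊨g (anteW V w □→ dep V)) ⇔
              (∀ p q → p ∈ L → q ∈ L → responseOf p V w ≡ responseOf q V w)
  ⊨g-□→dep⇔ V w L = mk⇔ to from
    where
      to : L ⊨g (anteW V w □→ dep V) → ∀ p q → p ∈ L → q ∈ L → responseOf p V w ≡ responseOf q V w
      to (inj₁ inconsistent) = ⊥-elim (anteW-consistent V w inconsistent)
      to (inj₂ dep-after) p@(s , F) q@(t , G) p∈ q∈ =
        trans (sym (update-same w V _))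
          (trans (dep-after _ (intervenedTeam-isIntv V w L) (intervenedPair V w p) (intervenedPair V w q)
                   (∈-map⁺ (intervenedPair V w) p∈) (∈-map⁺ (intervenedPair V w) q∈))
                 (update-same w V _))
      from : (∀ p q → p ∈ L → q ∈ L → responseOf p V w ≡ responseOf q V w) → L ⊨g (anteW V w □→ dep V)
      from same = inj₂ λ L′ L⇒L′ p′ q′ p′∈ q′∈ →
        let (s , F) , p∈ , (ivp , _) = Pointwise-∈ʳ L⇒L′ p′∈
            (t , G) , q∈ , (ivq , _) = Pointwise-∈ʳ L⇒L′ q′∈ in
        trans (isIntv-response F V w ivp) (trans (same _ _ p∈ q∈) (sym (isIntv-response G V w ivq)))

  ⊨g-χ⇔ : ∀ L → (L ⊨g χ) ⇔ (∀ p q → p ∈ L → q ∈ L → proj₁ p ≐ proj₁ q × SameResponses p q)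
  ⊨g-χ⇔ L = mk⇔ to from
    where
      to : L ⊨g χ → ∀ p q → p ∈ L → q ∈ L → proj₁ p ≐ proj₁ q × SameResponses p q
      to (counterfactuals , deps) p@(s , F) q@(t , G) p∈ q∈ =
        (λ V → Equivalence.to (⊨g-⋀-map⇔ dep allVars L) deps V (∈-allFin V) p q p∈ q∈) ,
        λ V w → let w′ , w′∈ , w′≐w = ranW-representative V w in begin
          response F s V w   ≡⟨ response-local F s V (λ W W≢V → sym (w′≐w W W≢V)) ⟩
          response F s V w′  ≡⟨ Equivalence.to (⊨g-□→dep⇔ V w′ L) (counterfactual V w′ w′∈) p q p∈ q∈ ⟩
          response G t V w′  ≡⟨ response-local G t V w′≐w ⟩
          response G t V w   ∎
        where
          open ≡-Reasoning
          counterfactual : ∀ V w → w ∈ ranW V → L ⊨g (anteW V w □→ dep V)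
          counterfactual V = Equivalence.to (⊨g-⋀-map⇔ _ (ranW V) L)
            (Equivalence.to (⊨g-⋀-map⇔ _ allVars L) counterfactuals V (∈-allFin V))
      from : (∀ p q → p ∈ L → q ∈ L → proj₁ p ≐ proj₁ q × SameResponses p q) → L ⊨g χ
      from hom =
        Equivalence.from (⊨g-⋀-map⇔ _ allVars L) (λ V _ → Equivalence.from (⊨g-⋀-map⇔ _ (ranW V) L) λ w _ →
          Equivalence.from (⊨g-□→dep⇔ V w L) λ p q p∈ q∈ → proj₂ (hom p q p∈ q∈) V w) ,
        Equivalence.from (⊨g-⋀-map⇔ dep allVars L) (λ V _ p q p∈ q∈ → proj₁ (hom p q p∈ q∈) V)

  ⊨g-⊥⇔empty : ∀ L → (L ⊨g ⊥F) ⇔ (∀ a → a ∉ L)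
  ⊨g-⊥⇔empty L = mk⇔
    (λ (holds , fails) a a∈ → fails a a∈ λ { b (here refl) → holds b a∈ ; b (there ()) })
    (λ empty → (λ a a∈ → ⊥-elim (empty a a∈)) , (λ a a∈ → ⊥-elim (empty a a∈)))

  ⊨g-χ⇔homogeneous : ∀ L → All (λ p → Compatible (proj₂ p) (proj₁ p)) L →
                     (L ⊨g χ) ⇔ Homogeneous ≈-decSetoid L
  ⊨g-χ⇔homogeneous L compat = ⇔-trans (⊨g-χ⇔ L) (mk⇔
    (λ hom p q p∈ q∈ → Equivalence.from (≈⇔ p∈ q∈) (hom p q p∈ q∈))
    (λ hom p q p∈ q∈ → Equivalence.to   (≈⇔ p∈ q∈) (hom p q p∈ q∈)))
    where
      ≈⇔ : ∀ {p q} → p ∈ L → q ∈ L → p ≈ q ⇔ (proj₁ p ≐ proj₁ q × SameResponses p q)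
      ≈⇔ {p} {q} p∈ q∈ = ≈⇔≐×sameResponses p q (All.lookup compat p∈) (All.lookup compat q∈)

  ⊨c-⋀-map⇔ : {B : Set} (f : B → Fml) (xs : List B) (T : CTeam) →
              (T ⊨c ⋀ (map f xs)) ⇔ (∀ x → x ∈ xs → T ⊨c f x)
  ⊨c-⋀-map⇔ f [] T = mk⇔ (λ _ _ ()) (λ _ → tt)
  ⊨c-⋀-map⇔ f (y ∷ ys) T = mk⇔
    (λ (fy , rest) → λ { x (here refl) → fy ; x (there x∈) → Equivalence.to (⊨c-⋀-map⇔ f ys T) rest x x∈ })
    (λ all → all y (here refl) , Equivalence.from (⊨c-⋀-map⇔ f ys T) (λ x x∈ → all x (there x∈)))

  ⊨c-⊥⇔empty : ∀ F L → ((L , F) ⊨c ⊥F) ⇔ (∀ a → a ∉ L)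
  ⊨c-⊥⇔empty F L = mk⇔
    (λ (holds , fails) a a∈ → fails a a∈ λ { b (here refl) → holds b a∈ ; b (there ()) })
    (λ empty → (λ a a∈ → ⊥-elim (empty a a∈)) , (λ a a∈ → ⊥-elim (empty a a∈)))

  ⊨c-χ⇔homogeneous : ∀ F L → ((L , F) ⊨c χ) ⇔ Homogeneous ≐-decSetoid L
  ⊨c-χ⇔homogeneous F L = mk⇔ to from
    where
      to : (L , F) ⊨c χ → Homogeneous ≐-decSetoid L
      to (_ , deps) s t s∈ t∈ V = Equivalence.to (⊨c-⋀-map⇔ dep allVars (L , F)) deps V (∈-allFin V) s t s∈ t∈
      after-intervention : Homogeneous ≐-decSetoid L → ∀ V w → (L , F) ⊨c (anteW V w □→ dep V)
      after-intervention hom V w = inj₂ λ L′ L⇒L′ t t′ t∈ t′∈ →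
        let s  , s∈  , iv  = Pointwise-∈ʳ L⇒L′ t∈
            s′ , s′∈ , iv′ = Pointwise-∈ʳ L⇒L′ t′∈ in
        trans (isIntv-response F V w iv)
          (trans (response-state F V w s s′ (hom s s′ s∈ s′∈ V))
                 (sym (isIntv-response F V w iv′)))
      from : Homogeneous ≐-decSetoid L → (L , F) ⊨c χ
      from hom =
        Equivalence.from (⊨c-⋀-map⇔ (λ V → ⋀ (map (λ w → anteW V w □→ dep V) (ranW V))) allVars (L , F))
          (λ V _ → Equivalence.from (⊨c-⋀-map⇔ (λ w → anteW V w □→ dep V) (ranW V) (L , F))
                     λ w _ → after-intervention hom V w) ,
        Equivalence.from (⊨c-⋀-map⇔ dep allVars (L , F)) (λ V _ s t s∈ t∈ → hom s t s∈ t∈ V)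

proposition5p4 : (n : ℕ) (r : Fin (suc n) → ℕ) (k : ℕ) →
    let open Sig n r in
    ((T : GTeam) → All (λ p → Recursive (proj₂ p) × Compatible (proj₂ p) (proj₁ p)) T →
       (T ⊨g (χ_ k)) ⇔ (∃ λ m → QuotientSize _≈_ T m × m ≤ k))
    ×
    ((T⁻ : List Asg) (F : SysFun) → Recursive F → All (Compatible F) T⁻ →
       ((T⁻ , F) ⊨c (χ_ k)) ⇔ (∃ λ m → QuotientSize _≐_ T⁻ m × m ≤ k))
proposition5p4 n r k =
  (λ T valid → ⇔-trans (generalized.sat⇔coveredByAtMost k T (All.map proj₂ valid))
                       (⇔-sym (quotientSize≤⇔coveredByAtMost ≈-decSetoid k T))) ,
  (λ T⁻ F _ compat → ⇔-trans (causal.sat⇔coveredByAtMost F k T⁻ compat)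
                       (⇔-sym (quotientSize≤⇔coveredByAtMost ≐-decSetoid k T⁻)))
  where
    open Sig n r
    open Signature n r
    module generalized = Counting ≈-decSetoid (λ p → Compatible (proj₂ p) (proj₁ p)) (λ k L → L ⊨g χ_ k)
      ⊨g-⊥⇔empty ⊨g-χ⇔homogeneous (λ _ _ → ⇔-refl)
    module causal F = Counting ≐-decSetoid (Compatible F) (λ k L → (L , F) ⊨c χ_ k)
      (⊨c-⊥⇔empty F) (λ L _ → ⊨c-χ⇔homogeneous F L) (λ _ _ → ⇔-refl)
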